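{- Let $0<q<1$. Let $A_q(t)=\sum_{n\ge0}A_{n,q}\frac{t^n}{[n]_q!}$ be a real power series with $A_{0,q}\ne0$, and define polynomials $A_{n,q}(x)$ by $A_q(t)\,e_q(tx)=\sum_{n\ge0}A_{n,q}(x)\frac{t^n}{[n]_q!}$. Let $B_{0,q},B_{1,q},\dots$ be defined by $\frac{1}{A_q(t)}=\sum_{n\ge0}B_{n,q}\frac{t^n}{[n]_q!}$ (so $B_{0,q}=1/A_{0,q}\ne0$). Then $A_{0,q}(x)=1/B_{0,q}$ and, for every $n\ge1$, \[ A_{n,q}(x)=\frac{(-1)^n}{B_{0,q}^{\,n+1}}\det N_n(x), \] where $N_n(x)$ is the $(n+1)\times(n+1)$ matrix with rows and columns indexed by $r,c\in\{0,\dots,n\}$, row $0$ equal to $(1,x,\dots,x^n)$, and entry in row $r\ge1$, column $c$ equal to $\left[\begin{smallmatrix} c\\ r-1\end{smallmatrix}\right]_qB_{c-r+1,q}$ if $c\ge r-1$ and $0$ otherwise.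
   Context: $[n]_q=\frac{1-q^n}{1-q}$, $[n]_q!=[1]_q\cdots[n]_q$ with $[0]_q!=1$, $\left[\begin{smallmatrix} n\\ k\end{smallmatrix}\right]_q=\frac{[n]_q!}{[k]_q![n-k]_q!}$, and $e_q(z)=\sum_{n\ge0}\frac{z^n}{[n]_q!}$. All series may be regarded as formal power series in $t$. -}

module Defs where

open import Level using (_⊔_)
open import Data.Nat using (ℕ; zero; suc; _∸_; _≤?_)
open import Data.Fin using (Fin; toℕ; punchIn) renaming (zero to fzero; suc to fsuc)
open import Relation.Nullary using (yes; no)
open import Algebra.Bundles using (CommutativeRing)

-- All notions are developed over an arbitrary commutative ring R.
-- Formal power series in t are coefficient sequences ℕ → Carrier.
module QDefs {c ℓ} (R : CommutativeRing c ℓ) where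
  open CommutativeRing R

  sumTo : ℕ → (ℕ → Carrier) → Carrier
  sumTo zero    f = 0#
  sumTo (suc n) f = sumTo n f + f n

  prodTo : ℕ → (ℕ → Carrier) → Carrier
  prodTo zero    f = 1#
  prodTo (suc n) f = prodTo n f * f n

  sumFin : (n : ℕ) → (Fin n → Carrier) → Carrier
  sumFin zero    f = 0#
  sumFin (suc n) f = f fzero + sumFin n (λ i → f (fsuc i))

  pow : Carrier → ℕ → Carrier
  pow x zero    = 1#
  pow x (suc n) = x * pow x n

  -- q-integer [n]_q = 1 + q + ... + q^(n-1)  ( = (1-q^n)/(1-q) for q ≠ 1 )
  qint : Carrier → ℕ → Carrier
  qint q n = sumTo n (pow q)

  qfact : Carrier → ℕ → Carrier
  qfact q n = prodTo n (λ i → qint q (suc i))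

  -- given inv i = 1/[i+1]_q, finv inv n = 1/[n]_q!
  finv : (ℕ → Carrier) → ℕ → Carrier
  finv inv n = prodTo n inv

  qbinom : Carrier → (ℕ → Carrier) → ℕ → ℕ → Carrier
  qbinom q inv n k with k ≤? n
  ... | yes _ = qfact q n * (finv inv k * finv inv (n ∸ k))
  ... | no  _ = 0#

  _⊛_ : (ℕ → Carrier) → (ℕ → Carrier) → ℕ → Carrier
  (f ⊛ g) n = sumTo (suc n) (λ k → f k * g (n ∸ k))

  egf : (ℕ → Carrier) → (ℕ → Carrier) → ℕ → Carrier
  egf inv a n = a n * finv inv n

  eqSeries : (ℕ → Carrier) → Carrier → ℕ → Carrier
  eqSeries inv x n = pow x n * finv inv n

  one : ℕ → Carrier
  one zero    = 1#
  one (suc n) = 0#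

  det : (n : ℕ) → (Fin n → Fin n → Carrier) → Carrier
  det zero    M = 1#
  det (suc n) M = sumFin (suc n) λ j →
    pow (- 1#) (toℕ j) * (M fzero j * det n (λ r c → M (fsuc r) (punchIn j c)))

  Nmat : Carrier → (ℕ → Carrier) → Carrier → (ℕ → Carrier) → (n : ℕ) →
         Fin (suc n) → Fin (suc n) → Carrier
  Nmat q inv x B n fzero     col = pow x (toℕ col)
  Nmat q inv x B n (fsuc r′) col with toℕ r′ ≤? toℕ col
  ... | yes _ = qbinom q inv (toℕ col) (toℕ r′) * B (toℕ col ∸ toℕ r′)
  ... | no  _ = 0#

{-# OPTIONS --safe #-}
-- Let aₖ = A_{k,q}/[k]_q!, βₖ = B_{k,q}/[k]_q! and eₖ = xᵏ/[k]_q! be the ordinary coefficients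
-- of A_q(t), 1/A_q(t) and e_q(tx), so that a ⊛ β = 1 and A_{m,q}(x) = [m]_q! (a ⊛ e)ₘ.
-- Multiplying row r ≥ 1 of Nₘ(x) by [r-1]_q! and dividing column c by [c]_q! leaves the matrix
-- with top row (e_c) over the Toeplitz rows (β_{c-r+1}), and divides the determinant by [m]_q!.
-- Deleting column j of the Toeplitz block leaves a block-triangular matrix of determinant
-- β₀ʲ H_{m-j}, where Hₖ is the determinant of the k × k Hessenberg matrix (β_{c+1-r}). Since
-- H_{k+1} is itself of the bordered shape, with top row (β_{c+1}), the same top-row expansion
-- gives H_{k+1} = Σⱼ (-1)ʲ β_{j+1} β₀ʲ H_{k-j}, whose solution is Hₖ = (-1)ᵏ β₀ᵏ⁺¹ aₖ because
-- β ⊛ a = 1. The expansion of the scaled Nₘ(x) is then (-1)ᵐ β₀ᵐ⁺¹ (a ⊛ e)ₘ.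
module Submission where

open import Data.Nat as ℕ using (ℕ; zero; suc; _∸_; _≤_; _<_; _≤?_; z≤n; s≤s)
open import Data.Nat.Properties using (≤-refl; ≤-pred; m<n⇒m<1+n; m∸n≤m; m∸[m∸n]≡n; m+[n∸m]≡n)
open import Data.Nat.Induction using (<-rec)
open import Data.Fin using (Fin; toℕ; punchIn; punchOut; _≟_) renaming (zero to fzero; suc to fsuc)
open import Data.Fin.Properties using (punchIn-punchOut)
open import Data.Vec.Functional using (removeAt)
open import Data.Product using (Σ; _×_; _,_)
open import Function using (_∘_)
open import Relation.Nullary using (yes; no; ¬_)
open import Relation.Nullary.Negation using (contradiction)
open import Relation.Binary.PropositionalEquality as ≡ using (_≡_; _≢_; cong)
open import Algebra.Bundles using (CommutativeRing)
import Algebra.Properties.Ring as RingProperties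
import Algebra.Properties.CommutativeSemigroup as CommutativeSemigroupProperties
import Algebra.Properties.CommutativeMonoid.Sum as MonoidSum
import Algebra.Solver.CommutativeMonoid as MonoidSolver
import Relation.Binary.Reasoning.Setoid as SetoidReasoning
open import Defs

module Series {c ℓ} (R : CommutativeRing c ℓ) where
  open CommutativeRing R hiding (zero)
  open QDefs R
  open RingProperties ring using (-1*x≈-x; -‿involutive)
  open CommutativeSemigroupProperties *-commutativeSemigroup using (interchange)
  open SetoidReasoning setoid
  open MonoidSum *-commutativeMonoid public
    using () renaming (sum to product; sum-remove to product-removeAt)

  sumTo-cong : ∀ n {f g} → (∀ i → i < n → f i ≈ g i) → sumTo n f ≈ sumTo n g
  sumTo-cong zero    f≈g = refl
  sumTo-cong (suc n) f≈g = +-cong (sumTo-cong n (λ i i<n → f≈g i (m<n⇒m<1+n i<n))) (f≈g n ≤-refl)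

  sumTo-suc : ∀ n f → sumTo (suc n) f ≈ f 0 + sumTo n (f ∘ suc)
  sumTo-suc zero    f = +-comm 0# (f 0)
  sumTo-suc (suc n) f = trans (+-congʳ (sumTo-suc n f)) (+-assoc _ _ _)

  sumTo-reverse : ∀ n f → sumTo (suc n) f ≈ sumTo (suc n) (λ k → f (n ∸ k))
  sumTo-reverse zero    f = refl
  sumTo-reverse (suc n) f = begin
    sumTo (suc n) f + f (suc n)                 ≈⟨ +-congʳ (sumTo-reverse n f) ⟩
    sumTo (suc n) (λ k → f (n ∸ k)) + f (suc n) ≈⟨ +-comm _ _ ⟩
    f (suc n) + sumTo (suc n) (λ k → f (n ∸ k)) ≈⟨ sumTo-suc (suc n) (λ k → f (suc n ∸ k)) ⟨
    sumTo (suc (suc n)) (λ k → f (suc n ∸ k))   ∎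

  *-distribˡ-sumTo : ∀ n x f → x * sumTo n f ≈ sumTo n (λ i → x * f i)
  *-distribˡ-sumTo zero    x f = zeroʳ x
  *-distribˡ-sumTo (suc n) x f = trans (distribˡ x _ _) (+-congʳ (*-distribˡ-sumTo n x f))

  ⊛-comm : ∀ f g n → (f ⊛ g) n ≈ (g ⊛ f) n
  ⊛-comm f g n = begin
    sumTo (suc n) (λ k → f k * g (n ∸ k))             ≈⟨ sumTo-reverse n _ ⟩
    sumTo (suc n) (λ k → f (n ∸ k) * g (n ∸ (n ∸ k))) ≈⟨ sumTo-cong (suc n) swap ⟩
    sumTo (suc n) (λ k → g k * f (n ∸ k))             ∎
    where
    swap : ∀ k → k < suc n → f (n ∸ k) * g (n ∸ (n ∸ k)) ≈ g k * f (n ∸ k)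
    swap k k<1+n = trans (*-comm _ _) (*-congʳ (reflexive (cong g (m∸[m∸n]≡n (≤-pred k<1+n)))))

  sumFin-cong : ∀ n {f g} → (∀ i → f i ≈ g i) → sumFin n f ≈ sumFin n g
  sumFin-cong zero    f≈g = refl
  sumFin-cong (suc n) f≈g = +-cong (f≈g fzero) (sumFin-cong n (f≈g ∘ fsuc))

  sumFin-≈0 : ∀ n {f} → (∀ i → f i ≈ 0#) → sumFin n f ≈ 0#
  sumFin-≈0 zero    f≈0 = refl
  sumFin-≈0 (suc n) f≈0 = trans (+-cong (f≈0 fzero) (sumFin-≈0 n (f≈0 ∘ fsuc))) (+-identityˡ 0#)

  *-distribˡ-sumFin : ∀ n x f → x * sumFin n f ≈ sumFin n (λ i → x * f i)
  *-distribˡ-sumFin zero    x f = zeroʳ x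
  *-distribˡ-sumFin (suc n) x f = trans (distribˡ x _ _) (+-congˡ (*-distribˡ-sumFin n x (f ∘ fsuc)))

  sumFin-toℕ : ∀ n f → sumFin n (f ∘ toℕ) ≈ sumTo n f
  sumFin-toℕ zero    f = refl
  sumFin-toℕ (suc n) f = trans (+-congˡ (sumFin-toℕ n (f ∘ suc))) (sym (sumTo-suc n f))

  prodTo-suc : ∀ n f → prodTo (suc n) f ≈ f 0 * prodTo n (f ∘ suc)
  prodTo-suc zero    f = *-comm 1# (f 0)
  prodTo-suc (suc n) f = trans (*-congʳ (prodTo-suc n f)) (*-assoc _ _ _)

  prodTo-inverse : ∀ n {f g} → (∀ i → f i * g i ≈ 1#) → prodTo n f * prodTo n g ≈ 1#
  prodTo-inverse zero    fg≈1 = *-identityˡ 1#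
  prodTo-inverse (suc n) {f} {g} fg≈1 = begin
    (prodTo n f * f n) * (prodTo n g * g n) ≈⟨ interchange _ _ _ _ ⟩
    (prodTo n f * prodTo n g) * (f n * g n) ≈⟨ *-cong (prodTo-inverse n fg≈1) (fg≈1 n) ⟩
    1# * 1#                                 ≈⟨ *-identityˡ 1# ⟩
    1#                                      ∎

  product-toℕ : ∀ n f → product {n} (f ∘ toℕ) ≈ prodTo n f
  product-toℕ zero    f = refl
  product-toℕ (suc n) f = trans (*-congˡ (product-toℕ n (f ∘ suc))) (sym (prodTo-suc n f))

  pow-+ : ∀ x m n → pow x (m ℕ.+ n) ≈ pow x m * pow x n
  pow-+ x zero    n = sym (*-identityˡ _)
  pow-+ x (suc m) n = trans (*-congˡ (pow-+ x m n)) (sym (*-assoc _ _ _))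

  pow-∸ : ∀ x {j m} → j ≤ m → pow x j * pow x (m ∸ j) ≈ pow x m
  pow-∸ x {j} {m} j≤m = trans (sym (pow-+ x j (m ∸ j))) (reflexive (cong (pow x) (m+[n∸m]≡n j≤m)))

  pow-inverse : ∀ {x y} → x * y ≈ 1# → ∀ k → pow x k * pow y k ≈ 1#
  pow-inverse xy≈1 zero    = *-identityˡ 1#
  pow-inverse {x} {y} xy≈1 (suc k) = begin
    (x * pow x k) * (y * pow y k) ≈⟨ interchange _ _ _ _ ⟩
    (x * y) * (pow x k * pow y k) ≈⟨ *-cong xy≈1 (pow-inverse xy≈1 k) ⟩
    1# * 1#                       ≈⟨ *-identityˡ 1# ⟩
    1#                            ∎

  sign : ℕ → Carrier
  sign = pow (- 1#)

  sign*sign≈1 : ∀ k → sign k * sign k ≈ 1#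
  sign*sign≈1 = pow-inverse (trans (-1*x≈-x (- 1#)) (-‿involutive 1#))

module Determinants {c ℓ} (R : CommutativeRing c ℓ) where
  open CommutativeRing R hiding (zero)
  open QDefs R
  open Series R
  open MonoidSolver *-commutativeMonoid using (solve; _⊕_; _⊜_)
  open SetoidReasoning setoid

  minor : ∀ {n} → (Fin (suc n) → Fin (suc n) → Carrier) → Fin (suc n) → Fin n → Fin n → Carrier
  minor M j r c = M (fsuc r) (punchIn j c)

  laplaceTerm : ∀ {n} → (Fin (suc n) → Fin (suc n) → Carrier) → Fin (suc n) → Carrier
  laplaceTerm {n} M j = sign (toℕ j) * (M fzero j * det n (minor M j))

  laplaceTerm-≈0 : ∀ {n} M j → det n (minor M j) ≈ 0# → laplaceTerm M j ≈ 0#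
  laplaceTerm-≈0 M j minor≈0 = trans (*-congˡ (trans (*-congˡ minor≈0) (zeroʳ _))) (zeroʳ _)

  det-cong : ∀ n {M M′} → (∀ r c → M r c ≈ M′ r c) → det n M ≈ det n M′
  det-cong zero    M≈M′ = refl
  det-cong (suc n) {M} {M′} M≈M′ = sumFin-cong (suc n) term
    where
    term : ∀ j → laplaceTerm M j ≈ laplaceTerm M′ j
    term j = *-congˡ (*-cong (M≈M′ fzero j) (det-cong n (λ r c → M≈M′ (fsuc r) (punchIn j c))))

  det-zeroColumn : ∀ n M (k : Fin n) → (∀ r → M r k ≈ 0#) → det n M ≈ 0#
  det-zeroColumn (suc n) M k column≈0 = sumFin-≈0 (suc n) term≈0
    where
    term≈0 : ∀ j → laplaceTerm M j ≈ 0#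
    term≈0 j with j ≟ k
    ... | yes ≡.refl = trans (*-congˡ (trans (*-congʳ (column≈0 fzero)) (zeroˡ _))) (zeroʳ _)
    ... | no j≢k = laplaceTerm-≈0 M j (det-zeroColumn n (minor M j) (punchOut j≢k) λ r →
            trans (reflexive (cong (M (fsuc r)) (punchIn-punchOut j≢k))) (column≈0 (fsuc r)))

  det-firstColumn : ∀ n M → (∀ r → M (fsuc r) fzero ≈ 0#) →
                    det (suc n) M ≈ M fzero fzero * det n (minor M fzero)
  det-firstColumn n M below≈0 = begin
    laplaceTerm M fzero + sumFin n (laplaceTerm M ∘ fsuc) ≈⟨ +-cong (*-identityˡ _) (sumFin-≈0 n term≈0) ⟩
    M fzero fzero * det n (minor M fzero) + 0#          ≈⟨ +-identityʳ _ ⟩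
    M fzero fzero * det n (minor M fzero)               ∎
    where
    term≈0 : ∀ i → laplaceTerm M (fsuc i) ≈ 0#
    term≈0 i = laplaceTerm-≈0 M (fsuc i) (det-zeroColumn n (minor M (fsuc i)) (punchOut 1+i≢0) λ r →
      trans (reflexive (cong (M (fsuc r)) (punchIn-punchOut 1+i≢0))) (below≈0 r))
      where
      1+i≢0 : fsuc i ≢ fzero
      1+i≢0 ()

  det-scaleRows : ∀ n M u → det n (λ r c → u r * M r c) ≈ product u * det n M
  det-scaleRows zero    M u = sym (*-identityˡ 1#)
  det-scaleRows (suc n) M u =
    trans (sumFin-cong (suc n) term) (sym (*-distribˡ-sumFin (suc n) (product u) (laplaceTerm M)))
    where
    term : ∀ j → laplaceTerm (λ r c → u r * M r c) j ≈ product u * laplaceTerm M j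
    term j = begin
      sign (toℕ j) * ((u fzero * M fzero j) * det n (λ r c → u (fsuc r) * minor M j r c))
        ≈⟨ *-congˡ (*-congˡ (det-scaleRows n (minor M j) (u ∘ fsuc))) ⟩
      sign (toℕ j) * ((u fzero * M fzero j) * (product (u ∘ fsuc) * det n (minor M j)))
        ≈⟨ solve 5 (λ s u₀ m p d → s ⊕ ((u₀ ⊕ m) ⊕ (p ⊕ d)) ⊜ (u₀ ⊕ p) ⊕ (s ⊕ (m ⊕ d))) refl
                   (sign (toℕ j)) (u fzero) (M fzero j) (product (u ∘ fsuc)) (det n (minor M j)) ⟩
      product u * laplaceTerm M j ∎

  det-scaleColumns : ∀ n M v → det n (λ r c → M r c * v c) ≈ product v * det n M
  det-scaleColumns zero    M v = sym (*-identityˡ 1#)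
  det-scaleColumns (suc n) M v =
    trans (sumFin-cong (suc n) term) (sym (*-distribˡ-sumFin (suc n) (product v) (laplaceTerm M)))
    where
    term : ∀ j → laplaceTerm (λ r c → M r c * v c) j ≈ product v * laplaceTerm M j
    term j = begin
      sign (toℕ j) * ((M fzero j * v j) * det n (λ r c → minor M j r c * removeAt v j c))
        ≈⟨ *-congˡ (*-congˡ (det-scaleColumns n (minor M j) (removeAt v j))) ⟩
      sign (toℕ j) * ((M fzero j * v j) * (product (removeAt v j) * det n (minor M j)))
        ≈⟨ solve 5 (λ s m vⱼ p d → s ⊕ ((m ⊕ vⱼ) ⊕ (p ⊕ d)) ⊜ (vⱼ ⊕ p) ⊕ (s ⊕ (m ⊕ d))) refl
                   (sign (toℕ j)) (M fzero j) (v j) (product (removeAt v j)) (det n (minor M j)) ⟩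
      (v j * product (removeAt v j)) * laplaceTerm M j ≈⟨ *-congʳ (product-removeAt {i = j} v) ⟨
      product v * laplaceTerm M j                      ∎

  detℕ : ℕ → (ℕ → ℕ → Carrier) → Carrier
  detℕ n F = det n (λ r c → F (toℕ r) (toℕ c))

  punchInℕ : ℕ → ℕ → ℕ
  punchInℕ zero    c       = suc c
  punchInℕ (suc j) zero    = zero
  punchInℕ (suc j) (suc c) = suc (punchInℕ j c)

  toℕ-punchIn : ∀ {n} (j : Fin (suc n)) (c : Fin n) → toℕ (punchIn j c) ≡ punchInℕ (toℕ j) (toℕ c)
  toℕ-punchIn fzero    c        = ≡.refl
  toℕ-punchIn (fsuc j) fzero    = ≡.refl
  toℕ-punchIn (fsuc j) (fsuc c) = cong suc (toℕ-punchIn j c)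

  detℕ-laplace : ∀ n F →
    detℕ (suc n) F ≈ sumTo (suc n) (λ j → sign j * (F 0 j * detℕ n (λ r c → F (suc r) (punchInℕ j c))))
  detℕ-laplace n F = trans (sumFin-cong (suc n) term) (sumFin-toℕ (suc n) termℕ)
    where
    termℕ : ℕ → Carrier
    termℕ j = sign j * (F 0 j * detℕ n (λ r c → F (suc r) (punchInℕ j c)))
    term : ∀ j → laplaceTerm (λ r c → F (toℕ r) (toℕ c)) j ≈ termℕ (toℕ j)
    term j = *-congˡ (*-congˡ (det-cong n λ r c → reflexive (cong (F (suc (toℕ r))) (toℕ-punchIn j c))))

  detℕ-firstColumn : ∀ n F → (∀ r → F (suc r) 0 ≈ 0#) →
    detℕ (suc n) F ≈ F 0 0 * detℕ n (λ r c → F (suc r) (suc c))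
  detℕ-firstColumn n F below≈0 = det-firstColumn n (λ r c → F (toℕ r) (toℕ c)) (below≈0 ∘ toℕ)

module ToeplitzDeterminants {c ℓ} (R : CommutativeRing c ℓ) where
  open CommutativeRing R hiding (zero)
  open QDefs R
  open Series R
  open Determinants R
  open RingProperties ring using (-1*x≈-x; -‿distribʳ-*; +-inverseʳ-unique)
  open MonoidSolver *-commutativeMonoid using (solve; _⊕_; _⊜_)
  open SetoidReasoning setoid

  module Toeplitz (β : ℕ → Carrier) where

    β₀ : Carrier
    β₀ = β 0

    upperToeplitz : ℕ → ℕ → Carrier
    upperToeplitz zero    k       = β k
    upperToeplitz (suc r) zero    = 0#
    upperToeplitz (suc r) (suc k) = upperToeplitz r k

    upperToeplitz-≤ : ∀ {r k} → r ≤ k → upperToeplitz r k ≡ β (k ∸ r)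
    upperToeplitz-≤ {zero}          _         = ≡.refl
    upperToeplitz-≤ {suc r} {suc k} (s≤s r≤k) = upperToeplitz-≤ r≤k

    upperToeplitz-≰ : ∀ {r k} → ¬ r ≤ k → upperToeplitz r k ≡ 0#
    upperToeplitz-≰ {zero}          r≰k = contradiction z≤n r≰k
    upperToeplitz-≰ {suc r} {zero}  r≰k = ≡.refl
    upperToeplitz-≰ {suc r} {suc k} r≰k = upperToeplitz-≰ (r≰k ∘ s≤s)

    hessenbergDet : ℕ → Carrier
    hessenbergDet k = detℕ k (λ r c → upperToeplitz r (suc c))

    bordered : (ℕ → Carrier) → ℕ → ℕ → Carrier
    bordered e zero    c = e c
    bordered e (suc r) c = upperToeplitz r c

    det-minor-upperToeplitz : ∀ j {n} → j ≤ n →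
      detℕ n (λ r c → upperToeplitz r (punchInℕ j c)) ≈ pow β₀ j * hessenbergDet (n ∸ j)
    det-minor-upperToeplitz zero            _         = sym (*-identityˡ _)
    det-minor-upperToeplitz (suc j) {suc n} (s≤s j≤n) =
      trans (detℕ-firstColumn n (λ r c → upperToeplitz r (punchInℕ (suc j) c)) (λ _ → refl))
        (trans (*-congˡ (det-minor-upperToeplitz j j≤n)) (sym (*-assoc _ _ _)))

    det-bordered-laplace : ∀ m e →
      detℕ (suc m) (bordered e) ≈ sumTo (suc m) (λ j → sign j * (e j * (pow β₀ j * hessenbergDet (m ∸ j))))
    det-bordered-laplace m e = trans (detℕ-laplace m (bordered e)) (sumTo-cong (suc m) λ j j<1+m →
      *-congˡ (*-congˡ (det-minor-upperToeplitz j (≤-pred j<1+m))))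

    module Inverse (a : ℕ → Carrier) (a⊛β≈one : ∀ n → (a ⊛ β) n ≈ one n) where

      hessenbergClosed : ℕ → Carrier
      hessenbergClosed k = sign k * (pow β₀ (suc k) * a k)

      hessenbergSum-convolution : ∀ m (w : ℕ → Carrier) → (∀ {j} → j < suc m → hessenbergDet j ≈ hessenbergClosed j) →
        sumTo (suc m) (λ j → sign j * (w j * (pow β₀ j * hessenbergDet (m ∸ j)))) ≈
        sign m * (pow β₀ (suc m) * (w ⊛ a) m)
      hessenbergSum-convolution m w closed = begin
        sumTo (suc m) (λ j → sign j * (w j * (pow β₀ j * hessenbergDet (m ∸ j))))
          ≈⟨ sumTo-cong (suc m) term ⟩
        sumTo (suc m) (λ j → sign m * (pow β₀ (suc m) * (w j * a (m ∸ j))))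
          ≈⟨ *-distribˡ-sumTo (suc m) (sign m) (λ j → pow β₀ (suc m) * (w j * a (m ∸ j))) ⟨
        sign m * sumTo (suc m) (λ j → pow β₀ (suc m) * (w j * a (m ∸ j)))
          ≈⟨ *-congˡ (*-distribˡ-sumTo (suc m) (pow β₀ (suc m)) (λ j → w j * a (m ∸ j))) ⟨
        sign m * (pow β₀ (suc m) * (w ⊛ a) m) ∎
        where
        term : ∀ j → j < suc m →
          sign j * (w j * (pow β₀ j * hessenbergDet (m ∸ j))) ≈ sign m * (pow β₀ (suc m) * (w j * a (m ∸ j)))
        term j j<1+m = begin
          sign j * (w j * (pow β₀ j * hessenbergDet (m ∸ j)))
            ≈⟨ *-congˡ (*-congˡ (*-congˡ (closed (s≤s (m∸n≤m m j))))) ⟩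
          sign j * (w j * (pow β₀ j * (sign (m ∸ j) * ((β₀ * pow β₀ (m ∸ j)) * a (m ∸ j)))))
            ≈⟨ solve 7 (λ s w p s′ b p′ x → s ⊕ (w ⊕ (p ⊕ (s′ ⊕ ((b ⊕ p′) ⊕ x))))
                                           ⊜ (s ⊕ s′) ⊕ ((b ⊕ (p ⊕ p′)) ⊕ (w ⊕ x))) refl
                       (sign j) (w j) (pow β₀ j) (sign (m ∸ j)) β₀ (pow β₀ (m ∸ j)) (a (m ∸ j)) ⟩
          (sign j * sign (m ∸ j)) * ((β₀ * (pow β₀ j * pow β₀ (m ∸ j))) * (w j * a (m ∸ j)))
            ≈⟨ *-cong (pow-∸ (- 1#) (≤-pred j<1+m)) (*-congʳ (*-congˡ (pow-∸ β₀ (≤-pred j<1+m)))) ⟩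
          sign m * (pow β₀ (suc m) * (w j * a (m ∸ j))) ∎

      shifted-convolution : ∀ i → ((β ∘ suc) ⊛ a) i ≈ - (β₀ * a (suc i))
      shifted-convolution i = +-inverseʳ-unique _ _ (begin
        β₀ * a (suc i) + ((β ∘ suc) ⊛ a) i ≈⟨ sumTo-suc (suc i) _ ⟨
        (β ⊛ a) (suc i)                    ≈⟨ ⊛-comm β a (suc i) ⟩
        (a ⊛ β) (suc i)                    ≈⟨ a⊛β≈one (suc i) ⟩
        0#                                 ∎)

      hessenbergDet-closed : ∀ k → hessenbergDet k ≈ hessenbergClosed k
      hessenbergDet-closed = <-rec _ step
        where
        step : ∀ k → (∀ {j} → j < k → hessenbergDet j ≈ hessenbergClosed j) → hessenbergDet k ≈ hessenbergClosed k
        step zero _ = sym (begin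
          1# * ((β₀ * 1#) * a 0) ≈⟨ *-identityˡ _ ⟩
          (β₀ * 1#) * a 0        ≈⟨ *-congʳ (*-identityʳ β₀) ⟩
          β₀ * a 0               ≈⟨ *-comm _ _ ⟩
          a 0 * β₀               ≈⟨ +-identityˡ _ ⟨
          0# + a 0 * β₀          ≈⟨ a⊛β≈one 0 ⟩
          1#                     ∎)
        -- hessenbergDet (suc i) is definitionally the determinant of bordered (β ∘ suc).
        step (suc i) closed = begin
          hessenbergDet (suc i)
            ≈⟨ det-bordered-laplace i (β ∘ suc) ⟩
          sumTo (suc i) (λ j → sign j * (β (suc j) * (pow β₀ j * hessenbergDet (i ∸ j))))
            ≈⟨ hessenbergSum-convolution i (β ∘ suc) closed ⟩
          sign i * (pow β₀ (suc i) * ((β ∘ suc) ⊛ a) i)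
            ≈⟨ *-congˡ (*-congˡ (shifted-convolution i)) ⟩
          sign i * (pow β₀ (suc i) * - (β₀ * a (suc i)))
            ≈⟨ *-congˡ (-‿distribʳ-* _ _) ⟨
          sign i * - (pow β₀ (suc i) * (β₀ * a (suc i)))
            ≈⟨ -‿distribʳ-* _ _ ⟨
          - (sign i * (pow β₀ (suc i) * (β₀ * a (suc i))))
            ≈⟨ -1*x≈-x _ ⟨
          - 1# * (sign i * (pow β₀ (suc i) * (β₀ * a (suc i))))
            ≈⟨ solve 5 (λ m s p b x → m ⊕ (s ⊕ (p ⊕ (b ⊕ x))) ⊜ (m ⊕ s) ⊕ ((b ⊕ p) ⊕ x)) refl
                       (- 1#) (sign i) (pow β₀ (suc i)) β₀ (a (suc i)) ⟩
          hessenbergClosed (suc i) ∎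

      det-bordered : ∀ m e → detℕ (suc m) (bordered e) ≈ sign m * (pow β₀ (suc m) * (a ⊛ e) m)
      det-bordered m e = begin
        detℕ (suc m) (bordered e)
          ≈⟨ det-bordered-laplace m e ⟩
        sumTo (suc m) (λ j → sign j * (e j * (pow β₀ j * hessenbergDet (m ∸ j))))
          ≈⟨ hessenbergSum-convolution m e (λ _ → hessenbergDet-closed _) ⟩
        sign m * (pow β₀ (suc m) * (e ⊛ a) m)
          ≈⟨ *-congˡ (*-congˡ (⊛-comm e a m)) ⟩
        sign m * (pow β₀ (suc m) * (a ⊛ e) m) ∎

module NmatrixFactorisation {c ℓ} (R : CommutativeRing c ℓ) where
  open CommutativeRing R hiding (zero)
  open QDefs R
  open Series R
  open Determinants R
  open ToeplitzDeterminants R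
  open MonoidSolver *-commutativeMonoid using (solve; _⊕_; _⊜_; id)
  open SetoidReasoning setoid

  module Nmatrix (q : Carrier) (inv : ℕ → Carrier) (inv-qint : ∀ i → qint q (suc i) * inv i ≈ 1#)
                 (x : Carrier) (B : ℕ → Carrier) where
    open Toeplitz (egf inv B) using (bordered; upperToeplitz-≤; upperToeplitz-≰)

    qfact*finv≈1 : ∀ n → qfact q n * finv inv n ≈ 1#
    qfact*finv≈1 n = prodTo-inverse n inv-qint

    qbinom-≤ : ∀ {n k} → k ≤ n → qbinom q inv n k ≡ qfact q n * (finv inv k * finv inv (n ∸ k))
    qbinom-≤ {n} {k} k≤n with k ≤? n
    ... | yes _   = ≡.refl
    ... | no  k≰n = contradiction k≤n k≰n

    rowScale : ℕ → Carrier
    rowScale zero    = 1#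
    rowScale (suc r) = finv inv r

    Nmat-factorisation : ∀ m (r c : Fin (suc m)) →
      Nmat q inv x B m r c ≈ (rowScale (toℕ r) * bordered (eqSeries inv x) (toℕ r) (toℕ c)) * qfact q (toℕ c)
    Nmat-factorisation m fzero col = sym (begin
      (1# * (pow x k * finv inv k)) * qfact q k ≈⟨ solve 3 (λ X F Q → (id ⊕ (X ⊕ F)) ⊕ Q ⊜ X ⊕ (Q ⊕ F)) refl _ _ _ ⟩
      pow x k * (qfact q k * finv inv k)        ≈⟨ *-congˡ (qfact*finv≈1 k) ⟩
      pow x k * 1#                              ≈⟨ *-identityʳ _ ⟩
      pow x k                                   ∎)
      where
      k = toℕ col
    Nmat-factorisation m (fsuc r) col with toℕ r ≤? toℕ col
    ... | yes r≤c = begin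
      qbinom q inv k j * B (k ∸ j)
        ≈⟨ *-congʳ (reflexive (qbinom-≤ r≤c)) ⟩
      (qfact q k * (finv inv j * finv inv (k ∸ j))) * B (k ∸ j)
        ≈⟨ solve 4 (λ Q F G b → (Q ⊕ (F ⊕ G)) ⊕ b ⊜ (F ⊕ (b ⊕ G)) ⊕ Q) refl _ _ _ _ ⟩
      (finv inv j * egf inv B (k ∸ j)) * qfact q k
        ≈⟨ *-congʳ (*-congˡ (reflexive (upperToeplitz-≤ r≤c))) ⟨
      (finv inv j * bordered (eqSeries inv x) (suc j) k) * qfact q k ∎
      where
      j = toℕ r
      k = toℕ col
    ... | no r≰c = sym (begin
      (finv inv (toℕ r) * bordered (eqSeries inv x) (suc (toℕ r)) (toℕ col)) * qfact q (toℕ col)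
        ≈⟨ *-congʳ (*-congˡ (reflexive (upperToeplitz-≰ r≰c))) ⟩
      (finv inv (toℕ r) * 0#) * qfact q (toℕ col)
        ≈⟨ trans (*-congʳ (zeroʳ _)) (zeroˡ _) ⟩
      0# ∎)

    scales-product : ∀ m → product {suc m} (qfact q ∘ toℕ) * product {suc m} (rowScale ∘ toℕ) ≈ qfact q m
    scales-product m = begin
      product {suc m} (qfact q ∘ toℕ) * (1# * product {m} (finv inv ∘ toℕ))
        ≈⟨ *-cong (product-toℕ (suc m) (qfact q)) (*-congˡ (product-toℕ m (finv inv))) ⟩
      (prodTo m (qfact q) * qfact q m) * (1# * prodTo m (finv inv))
        ≈⟨ solve 3 (λ P Q F → (P ⊕ Q) ⊕ (id ⊕ F) ⊜ Q ⊕ (P ⊕ F)) refl _ _ _ ⟩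
      qfact q m * (prodTo m (qfact q) * prodTo m (finv inv))
        ≈⟨ *-congˡ (prodTo-inverse m qfact*finv≈1) ⟩
      qfact q m * 1#
        ≈⟨ *-identityʳ _ ⟩
      qfact q m ∎

    det-Nmat : ∀ m → det (suc m) (Nmat q inv x B m) ≈ qfact q m * detℕ (suc m) (bordered (eqSeries inv x))
    det-Nmat m = begin
      det (suc m) (Nmat q inv x B m)
        ≈⟨ det-cong (suc m) {M′ = λ r c → (u r * M r c) * v c} (Nmat-factorisation m) ⟩
      det (suc m) (λ r c → (u r * M r c) * v c)
        ≈⟨ det-scaleColumns (suc m) (λ r c → u r * M r c) v ⟩
      product v * det (suc m) (λ r c → u r * M r c)
        ≈⟨ *-congˡ (det-scaleRows (suc m) M u) ⟩
      product v * (product u * det (suc m) M)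
        ≈⟨ *-assoc _ _ _ ⟨
      (product v * product u) * det (suc m) M
        ≈⟨ *-congʳ (scales-product m) ⟩
      qfact q m * detℕ (suc m) (bordered (eqSeries inv x)) ∎
      where
      u v : Fin (suc m) → Carrier
      u = rowScale ∘ toℕ
      v = qfact q ∘ toℕ
      M : Fin (suc m) → Fin (suc m) → Carrier
      M r c = bordered (eqSeries inv x) (toℕ r) (toℕ c)

mainTheorem5 : ∀ {c ℓ} (R : CommutativeRing c ℓ) → let open CommutativeRing R in let open QDefs R in
    (q : Carrier) (inv : ℕ → Carrier) → (∀ i → qint q (suc i) * inv i ≈ 1#) →
    (A : ℕ → Carrier) → Σ Carrier (λ a → A 0 * a ≈ 1#) →
    (x : Carrier) (Ax : ℕ → Carrier) →
    (∀ n → egf inv Ax n ≈ (egf inv A ⊛ eqSeries inv x) n) →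
    (B : ℕ → Carrier) → (∀ n → (egf inv A ⊛ egf inv B) n ≈ one n) →
    (b : Carrier) → B 0 * b ≈ 1# →
    (Ax 0 ≈ b) × (∀ n → Ax (suc n) ≈ pow (- 1#) (suc n) * (pow b (suc (suc n)) * det (suc (suc n)) (Nmat q inv x B (suc n))))
-- A 0 is invertible as a consequence of A ⊛ B ≈ 1.
mainTheorem5 R q inv inv-qint A _ x Ax Ax-def B A⊛B≈one b B₀b≈1 = Ax₀≈b , λ n → Ax-det (suc n)
  where
  open CommutativeRing R hiding (zero)
  open QDefs R
  open Series R
  open NmatrixFactorisation R
  open Nmatrix q inv inv-qint x B
  open ToeplitzDeterminants R
  open Toeplitz (egf inv B) using (β₀)
  open Toeplitz.Inverse (egf inv B) (egf inv A) A⊛B≈one using (det-bordered)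
  open MonoidSolver *-commutativeMonoid using (solve; _⊕_; _⊜_)
  open SetoidReasoning setoid

  bβ₀≈1 : b * β₀ ≈ 1#
  bβ₀≈1 = trans (*-congˡ (*-identityʳ _)) (trans (*-comm _ _) B₀b≈1)

  Ax-det : ∀ m → Ax m ≈ sign m * (pow b (suc m) * det (suc m) (Nmat q inv x B m))
  Ax-det m = sym (begin
    sign m * (pow b (suc m) * det (suc m) (Nmat q inv x B m))
      ≈⟨ *-congˡ (*-congˡ (trans (det-Nmat m) (*-congˡ (det-bordered m (eqSeries inv x))))) ⟩
    sign m * (pow b (suc m) * (qfact q m * (sign m * (pow β₀ (suc m) * (egf inv A ⊛ eqSeries inv x) m))))
      ≈⟨ *-congˡ (*-congˡ (*-congˡ (*-congˡ (*-congˡ (Ax-def m))))) ⟨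
    sign m * (pow b (suc m) * (qfact q m * (sign m * (pow β₀ (suc m) * (Ax m * finv inv m)))))
      ≈⟨ solve 6 (λ s p Q p′ X F → s ⊕ (p ⊕ (Q ⊕ (s ⊕ (p′ ⊕ (X ⊕ F))))) ⊜ (s ⊕ s) ⊕ ((p ⊕ p′) ⊕ ((Q ⊕ F) ⊕ X))) refl
                 (sign m) (pow b (suc m)) (qfact q m) (pow β₀ (suc m)) (Ax m) (finv inv m) ⟩
    (sign m * sign m) * ((pow b (suc m) * pow β₀ (suc m)) * ((qfact q m * finv inv m) * Ax m))
      ≈⟨ *-cong (sign*sign≈1 m) (*-cong (pow-inverse bβ₀≈1 (suc m)) (*-congʳ (qfact*finv≈1 m))) ⟩
    1# * (1# * (1# * Ax m))
      ≈⟨ trans (*-identityˡ _) (trans (*-identityˡ _) (*-identityˡ _)) ⟩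
    Ax m ∎)

  Ax₀≈b : Ax 0 ≈ b
  Ax₀≈b = begin
    Ax 0                                      ≈⟨ Ax-det 0 ⟩
    1# * ((b * 1#) * (1# * (1# * 1#) + 0#))   ≈⟨ *-identityˡ _ ⟩
    (b * 1#) * (1# * (1# * 1#) + 0#)          ≈⟨ *-cong (*-identityʳ b) (trans (+-identityʳ _) (trans (*-identityˡ _) (*-identityˡ _))) ⟩
    b * 1#                                    ≈⟨ *-identityʳ b ⟩
    b                                         ∎
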